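{- For all integers $n,k$ with $1\le k\le n-1$, the polynomials $W_{n,k}(t)=\sum_{m=0}^{k}w_{n,k,m}t^m$ and $W_{n,n-k}(t)=\sum_{m=0}^{n-k}w_{n,n-k,m}t^m$ have the same roots.
   Context: A Dyck path of semilength $n$ is a word in the letters $U,D$ with $n$ copies of each letter such that no prefix contains more $D$'s than $U$'s. A $UD$-factor (resp. $UUD$-factor) is an occurrence of $UD$ (resp. $UUD$) as a consecutive subword. $w_{n,k,m}$ denotes the number of Dyck paths of semilength $n$ with exactly $k$ $UD$-factors and exactly $m$ $UUD$-factors. -}

module Defs where

open import Level using (Level)
open import Data.Nat using (ℕ; zero; suc; _≡ᵇ_)
import Data.Nat as ℕ
open import Data.Bool using (Bool; true; false; _∧_; T?)
open import Data.Product using (_×_)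
open import Data.List using (List; []; _∷_; length; filter; concatMap; map)
open import Data.Sum using (_⊎_)
open import Relation.Nullary using (¬_)
open import Relation.Nullary.Decidable using (Dec)
open import Relation.Binary.PropositionalEquality using (_≡_)
open import Algebra.Bundles using (CommutativeRing)

data Step : Set where
  U D : Step

words : ℕ → List (List Step)
words zero    = [] ∷ []
words (suc ℓ) = concatMap (λ w → (U ∷ w) ∷ (D ∷ w) ∷ []) (words ℓ)

-- Prefix condition: h is the current height (#U − #D so far);
-- no prefix has more D's than U's, and the total ends at height 0.
dyckFrom : ℕ → List Step → Bool
dyckFrom zero    []      = true
dyckFrom (suc _) []      = false
dyckFrom h       (U ∷ w) = dyckFrom (suc h) w
dyckFrom zero    (D ∷ w) = false
dyckFrom (suc h) (D ∷ w) = dyckFrom h w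

isDyck : List Step → Bool
isDyck = dyckFrom zero

countUD : List Step → ℕ
countUD []            = zero
countUD (U ∷ D ∷ w)   = suc (countUD (D ∷ w))
countUD (_ ∷ w)       = countUD w

countUUD : List Step → ℕ
countUUD []              = zero
countUUD (U ∷ U ∷ D ∷ w) = suc (countUUD (U ∷ D ∷ w))
countUUD (_ ∷ w)         = countUUD w

-- Every word of length 2n with n U's and n D's satisfying the prefix
-- condition is a Dyck path of semilength n (dyckFrom forces equal counts).
dyckPaths : ℕ → List (List Step)
dyckPaths n = filter (λ w → T? (isDyck w)) (words (n ℕ.+ n))

wnkm : ℕ → ℕ → ℕ → ℕ
wnkm n k m =
  length (filter (λ w → T? ((countUD w ≡ᵇ k) ∧ (countUUD w ≡ᵇ m)))
                 (dyckPaths n))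

module _ {c ℓ : Level} (R : CommutativeRing c ℓ) where
  open CommutativeRing R using (Carrier; _≈_; _+_; _*_; 0#; 1#)

  ιℕ : ℕ → Carrier
  ιℕ zero    = 0#
  ιℕ (suc n) = 1# + ιℕ n

  pow : Carrier → ℕ → Carrier
  pow x zero    = 1#
  pow x (suc m) = x * pow x m

  polySum : (ℕ → ℕ) → ℕ → Carrier → Carrier
  polySum a zero    x = ιℕ (a zero)
  polySum a (suc j) x = polySum a j x + ιℕ (a (suc j)) * pow x (suc j)

  W : ℕ → ℕ → Carrier → Carrier
  W n k x = polySum (wnkm n k) k x

  IsIntegralDomain : Set (c Level.⊔ ℓ)
  IsIntegralDomain = (¬ (1# ≈ 0#)) × (∀ a b → a * b ≈ 0# → (a ≈ 0#) ⊎ (b ≈ 0#))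

  CharZero : Set ℓ
  CharZero = ∀ n → ¬ (ιℕ (suc n) ≈ 0#)

  SameRoots : (Carrier → Carrier) → (Carrier → Carrier) → Set (c Level.⊔ ℓ)
  SameRoots p q = ∀ x → ((p x ≈ 0# → q x ≈ 0#) × (q x ≈ 0# → p x ≈ 0#))

module Submission where

-- A word from height h down to 0 with k peaks UD and m factors UUD has d = e + k + h
-- down-steps, where e counts the up-steps not followed by a down-step. Splitting such words
-- by their first steps (D, UD, UUD, UUU) and eliminating the UUU-case gives a linear
-- recurrence in the length, which the closed form
--   (d + 1) · #words = (h + 1) · C(d + 1, k) · C(e - 1, m - 1) · C(k, m)
-- satisfies by three binomial identities. For h = 0 it reads
-- (n + 1) w_{n,k,m} = C(n + 1, k) C(n - k - 1, m - 1) C(k, m), and as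
-- k C(k - 1, m - 1) = m C(k, m), this makes the coefficients proportional:
--   (n - k) C(n + 1, n - k) W_{n,k} = k C(n + 1, k) W_{n,n-k}.
-- Over a domain of characteristic zero both factors are nonzero, so the two polynomials have
-- the same roots.

open import Defs
open import Level using (Level)
open import Data.Nat using (ℕ; zero; suc; _≤_; _∸_; s≤s; z≤n)
import Data.Nat as ℕ
import Data.Nat.Properties as ℕₚ
open import Algebra.Bundles using (CommutativeRing)
import Relation.Binary.PropositionalEquality as ≡

module Counting where

  open import Data.Nat using (_+_; _*_; _<_; _≡ᵇ_; NonZero; ≢-nonZero)
  open import Data.Nat.Properties
  open import Data.Nat.Induction using (<-rec)
  open import Data.Nat.ListAction using (sum)
  open import Data.Nat.Tactic.RingSolver using (solve-∀)
  open import Data.Bool using (T; true; false; _∧_; if_then_else_; T?)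
  open import Data.Bool.Properties using (∧-zeroʳ)
  open import Data.List using (List; []; _∷_; length; map; concatMap; filter)
  open import Data.Unit using (tt)
  open import Data.Empty using (⊥-elim)
  open import Data.Sum using (inj₁; inj₂)
  open import Relation.Binary.PropositionalEquality

  C : ℕ → ℕ → ℕ
  C n       zero    = 1
  C zero    (suc k) = 0
  C (suc n) (suc k) = C n k + C n (suc k)

  C-absorb : ∀ n k → suc k * C (suc n) (suc k) ≡ suc n * C n k
  C-absorb-complement : ∀ n k → k * C (suc n) k + suc n * C n k ≡ suc n * C (suc n) k

  C-absorb-complement n zero    = refl
  C-absorb-complement n (suc k) = begin
    suc k * C (suc n) (suc k) + suc n * C n (suc k) ≡⟨ cong (_+ suc n * C n (suc k)) (C-absorb n k) ⟩
    suc n * C n k + suc n * C n (suc k)             ≡⟨ *-distribˡ-+ (suc n) (C n k) (C n (suc k)) ⟨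
    suc n * C (suc n) (suc k)                       ∎
    where open ≡-Reasoning

  C-absorb zero    zero    = refl
  C-absorb zero    (suc k) = *-zeroʳ (suc (suc k))
  C-absorb (suc n) k       = begin
    suc k * (C (suc n) k + C (suc n) (suc k))               ≡⟨ *-distribˡ-+ (suc k) (C (suc n) k) _ ⟩
    suc k * C (suc n) k + suc k * C (suc n) (suc k)         ≡⟨ cong (suc k * C (suc n) k +_) (C-absorb n k) ⟩
    suc k * C (suc n) k + suc n * C n k                     ≡⟨ +-assoc (C (suc n) k) _ _ ⟩
    C (suc n) k + (k * C (suc n) k + suc n * C n k)         ≡⟨ cong (C (suc n) k +_) (C-absorb-complement n k) ⟩
    C (suc n) k + suc n * C (suc n) k                       ∎
    where open ≡-Reasoning

  C-ratio : ∀ a k → suc k * C (a + suc k) (suc k) ≡ suc a * C (a + suc k) k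
  C-ratio a k = +-cancelʳ-≡ _ _ _ (begin
    suc k * C (a + suc k) (suc k) + k * C (a + suc k) k   ≡⟨ cong (λ n → suc k * C n (suc k) + k * C n k) (+-suc a k) ⟩
    suc k * C n′ (suc k) + k * C n′ k                     ≡⟨ cong (_+ k * C n′ k) (C-absorb (a + k) k) ⟩
    suc (a + k) * C (a + k) k + k * C n′ k                ≡⟨ +-comm (suc (a + k) * C (a + k) k) _ ⟩
    k * C n′ k + suc (a + k) * C (a + k) k                ≡⟨ C-absorb-complement (a + k) k ⟩
    suc (a + k) * C n′ k                                  ≡⟨ *-distribʳ-+ (C n′ k) (suc a) k ⟩
    suc a * C n′ k + k * C n′ k                           ≡⟨ cong (λ n → suc a * C n k + k * C n k) (+-suc a k) ⟨
    suc a * C (a + suc k) k + k * C (a + suc k) k         ∎)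
    where
    open ≡-Reasoning
    n′ = suc (a + k)

  C-vanish : ∀ {n k} → n < k → C n k ≡ 0
  C-vanish {zero}  {suc k} _         = refl
  C-vanish {suc n} {suc k} (s≤s n<k) = cong₂ _+_ (C-vanish n<k) (C-vanish (m≤n⇒m≤1+n n<k))

  C-nonzero : ∀ {n k} → k ≤ n → C n k ≢ 0
  C-nonzero {k = zero}  _         ()
  C-nonzero {suc n} {suc k} (s≤s k≤n) eq = C-nonzero k≤n (m+n≡0⇒m≡0 (C n k) eq)

  -- comp e m = C (e - 1) (m - 1), the number of compositions of e into m positive parts.
  comp : ℕ → ℕ → ℕ
  comp zero    zero    = 1
  comp (suc e) zero    = 0
  comp zero    (suc m) = 0
  comp (suc e) (suc m) = C e m

  C-comp-pascal : ∀ e m → C e m ≡ comp e m + comp e (suc m)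
  C-comp-pascal zero    zero    = refl
  C-comp-pascal zero    (suc m) = refl
  C-comp-pascal (suc e) zero    = refl
  C-comp-pascal (suc e) (suc m) = refl

  comp-absorb : ∀ e m → e * comp e m + m * comp (suc e) m ≡ suc e * comp (suc e) m
  comp-absorb zero    zero          = refl
  comp-absorb (suc e) zero          = +-identityʳ (suc e * 0)
  comp-absorb zero    (suc zero)    = refl
  comp-absorb zero    (suc (suc m)) = *-zeroʳ (suc (suc m))
  comp-absorb (suc e) (suc m)       = begin
    suc e * C e m + suc m * C (suc e) m                 ≡⟨ cong (suc e * C e m +_) (+-comm (C (suc e) m) _) ⟩
    suc e * C e m + (m * C (suc e) m + C (suc e) m)      ≡⟨ +-assoc (suc e * C e m) _ _ ⟨
    suc e * C e m + m * C (suc e) m + C (suc e) m        ≡⟨ cong (_+ C (suc e) m) absorbed ⟩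
    suc e * C (suc e) m + C (suc e) m                    ≡⟨ +-comm (suc e * C (suc e) m) _ ⟩
    suc (suc e) * C (suc e) m                            ∎
    where
    open ≡-Reasoning
    absorbed : suc e * C e m + m * C (suc e) m ≡ suc e * C (suc e) m
    absorbed = trans (+-comm (suc e * C e m) _) (C-absorb-complement e m)

  comp-C : ∀ k m → k * comp k m ≡ m * C k m
  comp-C zero    zero    = refl
  comp-C zero    (suc m) = sym (*-zeroʳ (suc m))
  comp-C (suc k) zero    = *-zeroʳ (suc k)
  comp-C (suc k) (suc m) = sym (C-absorb k m)

  -- The ways to cut e + k up-steps into k ascents of which exactly m have length at least 2.
  A : ℕ → ℕ → ℕ → ℕ
  A e k m = comp e m * C k m

  lower : (ℕ → ℕ) → ℕ → ℕ
  lower f zero    = 0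
  lower f (suc n) = f n

  C-pascal : ∀ n k → C (suc n) k ≡ C n k + lower (C n) k
  C-pascal n zero    = refl
  C-pascal n (suc k) = +-comm (C n k) (C n (suc k))

  C-lower-ratio : ∀ e k h → k * C (e + k + h) k ≡ suc (e + h) * lower (C (e + k + h)) k
  C-lower-ratio e zero    h = sym (*-zeroʳ (suc (e + h)))
  C-lower-ratio e (suc k) h =
    subst (λ n → suc k * C n (suc k) ≡ suc (e + h) * C n k) (swap e k h) (C-ratio (e + h) k)
    where
    swap : ∀ e k h → e + h + suc k ≡ e + suc k + h
    swap = solve-∀

  A-pascal : ∀ e k m →
    A e (suc k) m + lower (λ e′ → A e′ k m) e ≡
    A e k m + lower (λ e′ → lower (A e′ k) m) e + lower (λ e′ → A e′ (suc k) m) e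
  A-pascal zero    k zero    = refl
  A-pascal zero    k (suc m) = refl
  A-pascal (suc e) k zero    = refl
  A-pascal (suc e) k (suc m) rewrite C-comp-pascal e m =
    identity (comp e m) (comp e (suc m)) (C k m) (C k (suc m))
    where
    identity : ∀ x y a b → (x + y) * (a + b) + y * b ≡ (x + y) * b + x * a + y * (a + b)
    identity = solve-∀

  A-absorb : ∀ e k m →
    e * A e k m + lower (λ e′ → A e′ k m) e + k * lower (λ k′ → A e k′ m) k ≡
    k * A e k m + e * lower (λ e′ → A e′ k m) e
  A-absorb zero    zero    m             = refl
  A-absorb zero    (suc k) zero          = sym (+-identityʳ _)
  A-absorb zero    (suc k) (suc m)       = sym (+-identityʳ _)
  A-absorb (suc e) zero    zero          with e
  ... | zero  = refl
  ... | suc _ = trans (+-identityʳ _) (+-identityʳ _)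
  A-absorb (suc e) zero    (suc m)
    rewrite *-zeroʳ (comp (suc e) (suc m)) | *-zeroʳ (comp e (suc m)) | *-zeroʳ (suc e) = refl
  A-absorb (suc e) (suc k) m = +-cancelʳ-≡ _ _ _ (begin
    suc e * (x₁ * c₁) + x₀ * c₁ + suc k * (x₁ * c₀) + m * (x₁ * c₁)
      ≡⟨ regroup₁ (suc e) k m c₀ c₁ x₀ x₁ ⟩
    suc e * (x₁ * c₁) + x₀ * c₁ + x₁ * (suc k * c₀ + m * c₁)
      ≡⟨ cong (λ z → suc e * (x₁ * c₁) + x₀ * c₁ + x₁ * z) C-step ⟩
    suc e * (x₁ * c₁) + x₀ * c₁ + x₁ * (suc k * c₁)
      ≡⟨ regroup₂ (suc e) k c₁ x₀ x₁ ⟩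
    suc k * (x₁ * c₁) + x₀ * c₁ + c₁ * (suc e * x₁)
      ≡⟨ cong (λ z → suc k * (x₁ * c₁) + x₀ * c₁ + c₁ * z) (comp-absorb e m) ⟨
    suc k * (x₁ * c₁) + x₀ * c₁ + c₁ * (e * x₀ + m * x₁)
      ≡⟨ regroup₃ e k m c₁ x₀ x₁ ⟩
    suc k * (x₁ * c₁) + suc e * (x₀ * c₁) + m * (x₁ * c₁)
      ∎)
    where
    open ≡-Reasoning
    x₀ = comp e m
    x₁ = comp (suc e) m
    c₀ = C k m
    c₁ = C (suc k) m
    C-step : suc k * c₀ + m * c₁ ≡ suc k * c₁
    C-step = trans (+-comm (suc k * c₀) _) (C-absorb-complement k m)
    regroup₁ : ∀ e k m c₀ c₁ x₀ x₁ → e * (x₁ * c₁) + x₀ * c₁ + suc k * (x₁ * c₀) + m * (x₁ * c₁)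
                                   ≡ e * (x₁ * c₁) + x₀ * c₁ + x₁ * (suc k * c₀ + m * c₁)
    regroup₁ = solve-∀
    regroup₂ : ∀ e k c₁ x₀ x₁ → e * (x₁ * c₁) + x₀ * c₁ + x₁ * (suc k * c₁)
                              ≡ suc k * (x₁ * c₁) + x₀ * c₁ + c₁ * (e * x₁)
    regroup₂ = solve-∀
    regroup₃ : ∀ e k m c₁ x₀ x₁ → suc k * (x₁ * c₁) + x₀ * c₁ + c₁ * (e * x₀ + m * x₁)
                                ≡ suc k * (x₁ * c₁) + suc e * (x₀ * c₁) + m * (x₁ * c₁)
    regroup₃ = solve-∀

  -- In the intended instance P = C(d, k), Q = C(d, k - 1), and α, β, γ, δ, ε are A at
  -- (e, k, m), (e, k - 1, m), (e - 1, k - 1, m - 1), (e - 1, k, m), (e - 1, k - 1, m).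
  -- The identity holds modulo the three hypotheses: adding the multiples of them in
  -- combination to both sides turns it into a polynomial identity.
  closedForm-recurrence : ∀ h e k P Q α β γ δ ε →
    Q * (α + ε) ≡ Q * (β + γ + δ) →
    e * α + δ + k * β ≡ k * α + e * δ →
    k * P ≡ suc (e + h) * Q →
    let d = e + k + h in
    d * (suc h * ((P + Q) * α)) + suc d * (suc (suc h) * (Q * ε) + suc h * (P * δ))
    ≡ d * (suc (suc h) * ((P + Q) * δ)) + suc d * (suc (suc h) * (Q * γ) + suc h * (Q * β) + h * (P * α))
  closedForm-recurrence h e k P Q α β γ δ ε pascal absorb ratio =
    +-cancelʳ-≡ _ _ _ (trans (identity h e k P Q α β γ δ ε) (cong (rhs +_) combination))
    where
    d = e + k + h
    rhs = d * (suc (suc h) * ((P + Q) * δ)) + suc d * (suc (suc h) * (Q * γ) + suc h * (Q * β) + h * (P * α))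
    combination :
      suc d * suc (suc h) * (Q * (α + ε)) + (P + Q) * (e * α + δ + k * β)
        + (α + α) * (k * P) + (δ + β) * (suc (e + h) * Q)
      ≡ suc d * suc (suc h) * (Q * (β + γ + δ)) + (P + Q) * (k * α + e * δ)
        + (α + α) * (suc (e + h) * Q) + (δ + β) * (k * P)
    combination = cong₂ _+_ (cong₂ _+_ (cong₂ _+_ (cong (suc d * suc (suc h) *_) pascal) (cong ((P + Q) *_) absorb))
                                       (cong ((α + α) *_) ratio))
                            (cong ((δ + β) *_) (sym ratio))
    identity : ∀ h e k P Q α β γ δ ε →
      (e + k + h) * (suc h * ((P + Q) * α)) + suc (e + k + h) * (suc (suc h) * (Q * ε) + suc h * (P * δ))
      + (suc (e + k + h) * suc (suc h) * (Q * (β + γ + δ)) + (P + Q) * (k * α + e * δ)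
         + (α + α) * (suc (e + h) * Q) + (δ + β) * (k * P))
      ≡ (e + k + h) * (suc (suc h) * ((P + Q) * δ))
        + suc (e + k + h) * (suc (suc h) * (Q * γ) + suc h * (Q * β) + h * (P * α))
      + (suc (e + k + h) * suc (suc h) * (Q * (α + ε)) + (P + Q) * (e * α + δ + k * β)
         + (α + α) * (k * P) + (δ + β) * (suc (e + h) * Q))
    identity = solve-∀

  closedForm-step : ∀ h e k P Q α β γ δ ε T₁ T₂ T₃ T₄ T₅ T₆ T₇ →
    Q * (α + ε) ≡ Q * (β + γ + δ) →
    e * α + δ + k * β ≡ k * α + e * δ →
    k * P ≡ suc (e + h) * Q →
    .{{_ : NonZero (e + k + h)}} →
    T₁ + T₂ + T₃ ≡ T₄ + T₅ + T₆ + T₇ →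
    (e + k + h) * T₂ ≡ suc (suc h) * (Q * ε) →
    (e + k + h) * T₃ ≡ suc h * (P * δ) →
    suc (e + k + h) * T₄ ≡ suc (suc h) * ((P + Q) * δ) →
    (e + k + h) * T₅ ≡ suc (suc h) * (Q * γ) →
    (e + k + h) * T₆ ≡ suc h * (Q * β) →
    (e + k + h) * T₇ ≡ h * (P * α) →
    suc (e + k + h) * T₁ ≡ suc h * ((P + Q) * α)
  closedForm-step h e k P Q α β γ δ ε T₁ T₂ T₃ T₄ T₅ T₆ T₇ pascal absorb ratio rec t₂ t₃ t₄ t₅ t₆ t₇ =
    *-cancelˡ-≡ _ _ d (+-cancelʳ-≡ _ _ _ (begin
      d * (suc d * T₁) + suc d * (suc (suc h) * (Q * ε) + suc h * (P * δ))
        ≡⟨ cong (λ z → d * (suc d * T₁) + suc d * z) (cong₂ _+_ t₂ t₃) ⟨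
      d * (suc d * T₁) + suc d * (d * T₂ + d * T₃)
        ≡⟨ scale d T₁ T₂ T₃ ⟩
      d * suc d * (T₁ + T₂ + T₃)
        ≡⟨ cong (d * suc d *_) rec ⟩
      d * suc d * (T₄ + T₅ + T₆ + T₇)
        ≡⟨ unscale d T₄ T₅ T₆ T₇ ⟩
      d * (suc d * T₄) + suc d * (d * T₅ + d * T₆ + d * T₇)
        ≡⟨ cong₂ (λ a b → d * a + suc d * b) t₄ (cong₂ _+_ (cong₂ _+_ t₅ t₆) t₇) ⟩
      d * (suc (suc h) * ((P + Q) * δ)) + suc d * (suc (suc h) * (Q * γ) + suc h * (Q * β) + h * (P * α))
        ≡⟨ closedForm-recurrence h e k P Q α β γ δ ε pascal absorb ratio ⟨
      d * (suc h * ((P + Q) * α)) + suc d * (suc (suc h) * (Q * ε) + suc h * (P * δ))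
        ∎))
    where
    open ≡-Reasoning
    d = e + k + h
    scale : ∀ d T₁ T₂ T₃ → d * (suc d * T₁) + suc d * (d * T₂ + d * T₃) ≡ d * suc d * (T₁ + T₂ + T₃)
    scale = solve-∀
    unscale : ∀ d T₄ T₅ T₆ T₇ →
      d * suc d * (T₄ + T₅ + T₆ + T₇) ≡ d * (suc d * T₄) + suc d * (d * T₅ + d * T₆ + d * T₇)
    unscale = solve-∀

  sum-words-suc : ∀ (f : List Step → ℕ) ℓ →
    sum (map f (words (suc ℓ)))
    ≡ sum (map (λ w → f (U ∷ w)) (words ℓ)) + sum (map (λ w → f (D ∷ w)) (words ℓ))
  sum-words-suc f ℓ = go (words ℓ)
    where
    interchange : ∀ a b x y → a + (b + (x + y)) ≡ a + x + (b + y)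
    interchange = solve-∀
    go : ∀ ws → sum (map f (concatMap (λ w → (U ∷ w) ∷ (D ∷ w) ∷ []) ws))
              ≡ sum (map (λ w → f (U ∷ w)) ws) + sum (map (λ w → f (D ∷ w)) ws)
    go []       = refl
    go (w ∷ ws) = trans (cong (λ s → f (U ∷ w) + (f (D ∷ w) + s)) (go ws))
                        (interchange (f (U ∷ w)) (f (D ∷ w)) _ _)

  sum-words-vanish : ∀ (f : List Step → ℕ) ℓ →
    (∀ w → length w ≡ ℓ → f w ≡ 0) → sum (map f (words ℓ)) ≡ 0
  sum-words-vanish f zero    f0 = cong (_+ 0) (f0 [] refl)
  sum-words-vanish f (suc ℓ) f0 = trans (sum-words-suc f ℓ)
    (cong₂ _+_ (sum-words-vanish _ ℓ (λ w ∣w∣ → f0 (U ∷ w) (cong suc ∣w∣)))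
               (sum-words-vanish _ ℓ (λ w ∣w∣ → f0 (D ∷ w) (cong suc ∣w∣))))

  counted : ℕ → ℕ → ℕ → List Step → ℕ
  counted h k m w = if dyckFrom h w ∧ (countUD w ≡ᵇ k) ∧ (countUUD w ≡ᵇ m) then 1 else 0

  paths pathsU pathsUU : ℕ → ℕ → ℕ → ℕ → ℕ
  paths   ℓ h k m = sum (map (counted h k m) (words ℓ))
  pathsU  ℓ h k m = sum (map (λ w → counted h k m (U ∷ w)) (words ℓ))
  pathsUU ℓ h k m = sum (map (λ w → counted h k m (U ∷ U ∷ w)) (words ℓ))

  counted-mismatch : ∀ h k m w → (countUD w ≡ᵇ k) ∧ (countUUD w ≡ᵇ m) ≡ false → counted h k m w ≡ 0
  counted-mismatch h k m w mismatch rewrite mismatch | ∧-zeroʳ (dyckFrom h w) = refl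

  paths-startD : ∀ ℓ h k m →
    sum (map (λ w → counted h k m (D ∷ w)) (words ℓ)) ≡ lower (λ h′ → paths ℓ h′ k m) h
  paths-startD ℓ zero    k m = sum-words-vanish _ ℓ (λ _ _ → refl)
  paths-startD ℓ (suc h) k m = refl

  paths-startUD : ∀ ℓ h k m →
    sum (map (λ w → counted h k m (U ∷ D ∷ w)) (words ℓ)) ≡ lower (λ k′ → paths ℓ h k′ m) k
  paths-startUD ℓ h       zero    m = sum-words-vanish _ ℓ (λ w _ → counted-mismatch h 0 m (U ∷ D ∷ w) refl)
  paths-startUD ℓ zero    (suc k) m = refl
  paths-startUD ℓ (suc h) (suc k) m = refl

  paths-startUUU : ∀ ℓ h k m →
    sum (map (λ w → counted h k m (U ∷ U ∷ U ∷ w)) (words ℓ)) ≡ pathsUU ℓ (suc h) k m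
  paths-startUUU ℓ zero    k m = refl
  paths-startUUU ℓ (suc h) k m = refl

  paths-startUUD : ∀ ℓ h k m →
    sum (map (λ w → counted h k m (U ∷ U ∷ D ∷ w)) (words ℓ)) ≡ lower (λ k′ → lower (paths ℓ (suc h) k′) m) k
  paths-startUUD ℓ h       zero    m       =
    sum-words-vanish _ ℓ (λ w _ → counted-mismatch h 0 m (U ∷ U ∷ D ∷ w) refl)
  paths-startUUD ℓ h       (suc k) zero    =
    sum-words-vanish _ ℓ (λ w _ → counted-mismatch h (suc k) 0 (U ∷ U ∷ D ∷ w) (∧-zeroʳ (countUD w ≡ᵇ k)))
  paths-startUUD ℓ zero    (suc k) (suc m) = refl
  paths-startUUD ℓ (suc h) (suc k) (suc m) = refl

  paths-suc : ∀ ℓ h k m → paths (suc ℓ) h k m ≡ pathsU ℓ h k m + lower (λ h′ → paths ℓ h′ k m) h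
  paths-suc ℓ h k m = trans (sum-words-suc (counted h k m) ℓ) (cong (pathsU ℓ h k m +_) (paths-startD ℓ h k m))

  pathsU-suc : ∀ ℓ h k m → pathsU (suc ℓ) h k m ≡ pathsUU ℓ h k m + lower (λ k′ → paths ℓ h k′ m) k
  pathsU-suc ℓ h k m =
    trans (sum-words-suc (λ w → counted h k m (U ∷ w)) ℓ) (cong (pathsUU ℓ h k m +_) (paths-startUD ℓ h k m))

  pathsUU-suc : ∀ ℓ h k m →
    pathsUU (suc ℓ) h k m ≡ pathsUU ℓ (suc h) k m + lower (λ k′ → lower (paths ℓ (suc h) k′) m) k
  pathsUU-suc ℓ h k m = trans (sum-words-suc (λ w → counted h k m (U ∷ U ∷ w)) ℓ)
                              (cong₂ _+_ (paths-startUUU ℓ h k m) (paths-startUUD ℓ h k m))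

  -- Split words of length ℓ + 3 from height h by their first steps D, UD, UUD, UUU, and words
  -- of length ℓ + 2 from height h + 1 by D, UD, UU; the UUU- and UU-counts then coincide.
  paths-recurrence : ∀ ℓ h k m →
    paths (3 + ℓ) h k m + lower (λ k′ → paths ℓ (suc h) k′ m) k + paths (1 + ℓ) h k m
    ≡ paths (2 + ℓ) (suc h) k m + lower (λ k′ → lower (paths ℓ (suc h) k′) m) k
      + lower (λ k′ → paths (1 + ℓ) h k′ m) k + lower (λ h′ → paths (2 + ℓ) h′ k m) h
  paths-recurrence ℓ h k m = begin
    paths (3 + ℓ) h k m + G₁ + F₁
      ≡⟨ cong (λ z → z + G₁ + F₁) unfold₃ ⟩
    pathsUU ℓ (suc h) k m + G₂ + G₁′ + D₂ + G₁ + F₁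
      ≡⟨ shuffle (pathsUU ℓ (suc h) k m) G₂ G₁′ D₂ G₁ F₁ ⟩
    pathsUU ℓ (suc h) k m + G₁ + F₁ + G₂ + G₁′ + D₂
      ≡⟨ cong (λ z → z + G₂ + G₁′ + D₂) unfold₂ ⟨
    paths (2 + ℓ) (suc h) k m + G₂ + G₁′ + D₂
      ∎
    where
    open ≡-Reasoning
    G₁  = lower (λ k′ → paths ℓ (suc h) k′ m) k
    G₂  = lower (λ k′ → lower (paths ℓ (suc h) k′) m) k
    G₁′ = lower (λ k′ → paths (1 + ℓ) h k′ m) k
    D₂  = lower (λ h′ → paths (2 + ℓ) h′ k m) h
    F₁  = paths (1 + ℓ) h k m
    unfold₃ : paths (3 + ℓ) h k m ≡ pathsUU ℓ (suc h) k m + G₂ + G₁′ + D₂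
    unfold₃ = trans (paths-suc (2 + ℓ) h k m) (cong (_+ D₂)
                (trans (pathsU-suc (1 + ℓ) h k m) (cong (_+ G₁′) (pathsUU-suc ℓ h k m))))
    unfold₂ : paths (2 + ℓ) (suc h) k m ≡ pathsUU ℓ (suc h) k m + G₁ + F₁
    unfold₂ = trans (paths-suc (1 + ℓ) (suc h) k m) (cong (_+ F₁) (pathsU-suc ℓ (suc h) k m))
    shuffle : ∀ u g₂ g₁′ d₂ g₁ f₁ → u + g₂ + g₁′ + d₂ + g₁ + f₁ ≡ u + g₁ + f₁ + g₂ + g₁′ + d₂
    shuffle = solve-∀

  ups : List Step → ℕ
  ups []      = 0
  ups (U ∷ w) = suc (ups w)
  ups (D ∷ w) = ups w

  dyckFrom-U : ∀ h w → dyckFrom h (U ∷ w) ≡ dyckFrom (suc h) w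
  dyckFrom-U zero    w = refl
  dyckFrom-U (suc h) w = refl

  dyck-length : ∀ h w → dyckFrom h w ≡ true → length w ≡ ups w + ups w + h
  dyck-length zero    []      _   = refl
  dyck-length h       (U ∷ w) eq  =
    trans (cong suc (dyck-length (suc h) w (trans (sym (dyckFrom-U h w)) eq))) (rebalance (ups w) h)
    where
    rebalance : ∀ u h → suc (u + u + suc h) ≡ suc u + suc u + h
    rebalance = solve-∀
  dyck-length (suc h) (D ∷ w) eq  = trans (cong suc (dyck-length h w eq)) (sym (+-suc (ups w + ups w) h))

  countUD≤ups : ∀ w → countUD w ≤ ups w
  countUD≤ups []          = z≤n
  countUD≤ups (U ∷ [])    = z≤n
  countUD≤ups (U ∷ D ∷ w) = s≤s (countUD≤ups w)
  countUD≤ups (U ∷ U ∷ w) = m≤n⇒m≤1+n (countUD≤ups (U ∷ w))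
  countUD≤ups (D ∷ w)     = countUD≤ups w

  counted-short : ∀ h k m w → length w < k + k + h → counted h k m w ≡ 0
  counted-short h k m w short with dyckFrom h w in dyck | countUD w ≡ᵇ k in peaks
  ... | false | _     = refl
  ... | true  | false = refl
  ... | true  | true  = ⊥-elim (<⇒≱ short long)
    where
    k≤ups : k ≤ ups w
    k≤ups = subst (_≤ ups w) (≡ᵇ⇒≡ (countUD w) k (subst T (sym peaks) tt)) (countUD≤ups w)
    long : k + k + h ≤ length w
    long = subst (k + k + h ≤_) (sym (dyck-length h w dyck)) (+-monoˡ-≤ h (+-mono-≤ k≤ups k≤ups))

  paths-short : ∀ ℓ h k m → ℓ < k + k + h → paths ℓ h k m ≡ 0
  paths-short ℓ h k m short =
    sum-words-vanish (counted h k m) ℓ (λ w ∣w∣ → counted-short h k m w (subst (_< k + k + h) (sym ∣w∣) short))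

  -- A word from height h to 0 with k peaks and e up-steps not followed by a down-step
  -- has e + k + h down-steps and length pathLength e k h.
  pathLength : ℕ → ℕ → ℕ → ℕ
  pathLength e k h = (e + k) + (e + k) + h

  pathLength-sucᵉ : ∀ e k h → pathLength (suc e) k h ≡ 2 + pathLength e k h
  pathLength-sucᵉ e k h = cong (λ x → suc x + h) (+-suc (e + k) (e + k))

  pathLength-sucᵏ : ∀ e k h → pathLength e (suc k) h ≡ 2 + pathLength e k h
  pathLength-sucᵏ e k h = trans (cong (λ x → x + x + h) (+-suc e k)) (pathLength-sucᵉ 0 (e + k) h)

  pathLength-sucʰ : ∀ e k h → pathLength e k (suc h) ≡ 1 + pathLength e k h
  pathLength-sucʰ e k h = +-suc (e + k + (e + k)) h

  PathFormula : ℕ → Set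
  PathFormula ℓ = ∀ h e k m → ℓ ≡ pathLength e k h →
    suc (e + k + h) * paths ℓ h k m ≡ suc h * (C (suc (e + k + h)) k * A e k m)

  shorter : ∀ j {ℓ n} → suc (j + ℓ) ≡ n → ℓ < n
  shorter j {ℓ} eq = subst (ℓ <_) eq (s≤s (m≤n+m ℓ j))

  *-vanish : ∀ a b {p q} → p ≡ 0 → q ≡ 0 → a * p ≡ b * q
  *-vanish a b refl refl = trans (*-zeroʳ a) (sym (*-zeroʳ b))

  -- The terms of paths-recurrence, by the induction hypothesis at the shifted parameters; a term
  -- whose parameter would become negative vanishes, by paths-short when it is e.
  formula[e,k-1,h] : ∀ ℓ h e k m → PathFormula (1 + ℓ) → 3 + ℓ ≡ pathLength e k h →
    (e + k + h) * lower (λ k′ → paths (1 + ℓ) h k′ m) k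
    ≡ suc h * (lower (C (e + k + h)) k * lower (λ k′ → A e k′ m) k)
  formula[e,k-1,h] ℓ h e zero    m IH eq = *-vanish (e + 0 + h) (suc h) refl refl
  formula[e,k-1,h] ℓ h e (suc k) m IH eq =
    subst (λ d → d * paths (1 + ℓ) h k m ≡ suc h * (C d k * A e k m)) (sym (cong (_+ h) (+-suc e k)))
      (IH h e k m (+-cancelˡ-≡ 2 _ _ (trans eq (pathLength-sucᵏ e k h))))

  formula[e,k,h-1] : ∀ ℓ h e k m → PathFormula (2 + ℓ) → 3 + ℓ ≡ pathLength e k h →
    (e + k + h) * lower (λ h′ → paths (2 + ℓ) h′ k m) h ≡ h * (C (e + k + h) k * A e k m)
  formula[e,k,h-1] ℓ zero    e k m IH eq = *-zeroʳ (e + k + 0)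
  formula[e,k,h-1] ℓ (suc h) e k m IH eq =
    subst (λ d → d * paths (2 + ℓ) h k m ≡ suc h * (C d k * A e k m)) (sym (+-suc (e + k) h))
      (IH h e k m (suc-injective (trans eq (pathLength-sucʰ e k h))))

  formula[e-1,k,h] : ∀ ℓ h e k m → PathFormula (1 + ℓ) → 3 + ℓ ≡ pathLength e k h →
    (e + k + h) * paths (1 + ℓ) h k m ≡ suc h * (C (e + k + h) k * lower (λ e′ → A e′ k m) e)
  formula[e-1,k,h] ℓ h zero    k m IH eq =
    *-vanish (k + h) (suc h) (paths-short (1 + ℓ) h k m (shorter 1 eq)) (*-zeroʳ (C (k + h) k))
  formula[e-1,k,h] ℓ h (suc e) k m IH eq = IH h e k m (+-cancelˡ-≡ 2 _ _ (trans eq (pathLength-sucᵉ e k h)))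

  formula[e-1,k,h+1] : ∀ ℓ h e k m → PathFormula (2 + ℓ) → 3 + ℓ ≡ pathLength e k h →
    suc (e + k + h) * paths (2 + ℓ) (suc h) k m
    ≡ suc (suc h) * (C (suc (e + k + h)) k * lower (λ e′ → A e′ k m) e)
  formula[e-1,k,h+1] ℓ h zero    k m IH eq =
    *-vanish (suc (k + h)) (suc (suc h))
      (paths-short (2 + ℓ) (suc h) k m (shorter 1 short)) (*-zeroʳ (C (suc (k + h)) k))
    where
    short : 4 + ℓ ≡ k + k + suc h
    short = trans (cong suc eq) (sym (+-suc (k + k) h))
  formula[e-1,k,h+1] ℓ h (suc e) k m IH eq =
    subst (λ d → suc d * paths (2 + ℓ) (suc h) k m ≡ suc (suc h) * (C (suc d) k * A e k m)) (+-suc (e + k) h)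
      (IH (suc h) e k m (trans (+-cancelˡ-≡ 1 _ _ (trans eq (pathLength-sucᵉ e k h))) (sym (pathLength-sucʰ e k h))))

  formula[e-1,k-1,h+1] : ∀ ℓ h e k m → PathFormula ℓ → 3 + ℓ ≡ pathLength e k h →
    (e + k + h) * lower (λ k′ → paths ℓ (suc h) k′ m) k
    ≡ suc (suc h) * (lower (C (e + k + h)) k * lower (λ e′ → lower (λ k′ → A e′ k′ m) k) e)
  formula[e-1,k-1,h+1] ℓ h e       zero    m IH eq = *-vanish (e + 0 + h) (suc (suc h)) refl refl
  formula[e-1,k-1,h+1] ℓ h zero    (suc k) m IH eq =
    *-vanish (suc k + h) (suc (suc h)) (paths-short ℓ (suc h) k m (shorter 1 short)) (*-zeroʳ (C (suc k + h) k))
    where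
    short : 2 + ℓ ≡ k + k + suc h
    short = trans (+-cancelˡ-≡ 1 _ _ (trans eq (pathLength-sucᵏ 0 k h))) (sym (+-suc (k + k) h))
  formula[e-1,k-1,h+1] ℓ h (suc e) (suc k) m IH eq =
    subst (λ d → d * paths ℓ (suc h) k m ≡ suc (suc h) * (C d k * A e k m)) (reassoc e k h)
      (IH (suc h) e k m (trans (+-cancelˡ-≡ 3 _ _ lengths) (sym (pathLength-sucʰ e k h))))
    where
    reassoc : ∀ e k h → suc (e + k + suc h) ≡ suc e + suc k + h
    reassoc = solve-∀
    lengths : 3 + ℓ ≡ 3 + suc (pathLength e k h)
    lengths = trans eq (trans (pathLength-sucᵉ e (suc k) h) (cong (2 +_) (pathLength-sucᵏ e k h)))

  formula[e-1,k-1,h+1,m-1] : ∀ ℓ h e k m → PathFormula ℓ → 3 + ℓ ≡ pathLength e k h →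
    (e + k + h) * lower (λ k′ → lower (paths ℓ (suc h) k′) m) k
    ≡ suc (suc h) * (lower (C (e + k + h)) k * lower (λ e′ → lower (λ k′ → lower (A e′ k′) m) k) e)
  formula[e-1,k-1,h+1,m-1] ℓ h e       zero    m       IH eq = *-vanish (e + 0 + h) (suc (suc h)) refl refl
  formula[e-1,k-1,h+1,m-1] ℓ h zero    (suc k) zero    IH eq =
    *-vanish (suc k + h) (suc (suc h)) refl (*-zeroʳ (C (suc k + h) k))
  formula[e-1,k-1,h+1,m-1] ℓ h (suc e) (suc k) zero    IH eq =
    *-vanish (suc e + suc k + h) (suc (suc h)) refl (*-zeroʳ (C (suc e + suc k + h) k))
  formula[e-1,k-1,h+1,m-1] ℓ h e       (suc k) (suc m) IH eq = formula[e-1,k-1,h+1] ℓ h e (suc k) m IH eq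

  formula-step : ∀ ℓ → PathFormula ℓ → PathFormula (1 + ℓ) → PathFormula (2 + ℓ) → PathFormula (3 + ℓ)
  formula-step ℓ IH₀ IH₁ IH₂ h e k m eq =
    subst (λ c → suc d * paths (3 + ℓ) h k m ≡ suc h * (c * A e k m)) (sym (C-pascal d k))
      (closedForm-step h e k (C d k) (lower (C d) k) (A e k m)
         (lower (λ k′ → A e k′ m) k)
         (lower (λ e′ → lower (λ k′ → lower (A e′ k′) m) k) e)
         (lower (λ e′ → A e′ k m) e)
         (lower (λ e′ → lower (λ k′ → A e′ k′ m) k) e)
         _ _ _ _ _ _ _
         (A-pascal-lower e k m) (A-absorb e k m) (C-lower-ratio e k h) {{≢-nonZero d≢0}}
         (paths-recurrence ℓ h k m)
         (formula[e-1,k-1,h+1] ℓ h e k m IH₀ eq)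
         (formula[e-1,k,h] ℓ h e k m IH₁ eq)
         (subst (λ c → suc d * paths (2 + ℓ) (suc h) k m ≡ suc (suc h) * (c * lower (λ e′ → A e′ k m) e))
                (C-pascal d k) (formula[e-1,k,h+1] ℓ h e k m IH₂ eq))
         (formula[e-1,k-1,h+1,m-1] ℓ h e k m IH₀ eq)
         (formula[e,k-1,h] ℓ h e k m IH₁ eq)
         (formula[e,k,h-1] ℓ h e k m IH₂ eq))
    where
    d = e + k + h
    A-pascal-lower : ∀ e k m →
      lower (C d) k * (A e k m + lower (λ e′ → lower (λ k′ → A e′ k′ m) k) e)
      ≡ lower (C d) k * (lower (λ k′ → A e k′ m) k + lower (λ e′ → lower (λ k′ → lower (A e′ k′) m) k) e
                         + lower (λ e′ → A e′ k m) e)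
    A-pascal-lower e zero    m = refl
    A-pascal-lower e (suc k) m = cong (C d k *_) (A-pascal e k m)
    doubled : ∀ e k h → (e + k) + (e + k) + h + h ≡ (e + k + h) + (e + k + h)
    doubled = solve-∀
    d≢0 : d ≢ 0
    d≢0 d≡0 = 1+n≢0 (m+n≡0⇒m≡0 (3 + ℓ)
      (trans (cong (_+ h) eq) (trans (doubled e k h) (cong₂ _+_ d≡0 d≡0))))

  formula-0 : PathFormula 0
  formula-0 zero    zero    zero    zero    eq = refl
  formula-0 zero    zero    zero    (suc m) eq = refl
  formula-0 (suc h) zero    zero    m       ()
  formula-0 h       zero    (suc k) m       eq with trans eq (pathLength-sucᵏ 0 k h)
  ... | ()
  formula-0 h       (suc e) k       m       ()

  formula-1 : PathFormula 1
  formula-1 (suc zero)    zero    zero    zero    eq = refl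
  formula-1 (suc zero)    zero    zero    (suc m) eq = refl
  formula-1 zero          zero    zero    m       ()
  formula-1 (suc (suc h)) zero    zero    m       ()
  formula-1 h             zero    (suc k) m       eq with trans eq (pathLength-sucᵏ 0 k h)
  ... | ()
  formula-1 h             (suc e) k       m       eq with trans eq (pathLength-sucᵉ e k h)
  ... | ()

  formula-2 : PathFormula 2
  formula-2 (suc (suc zero))    zero       zero       zero          eq = refl
  formula-2 (suc (suc zero))    zero       zero       (suc m)       eq = refl
  formula-2 zero                zero       zero       m             ()
  formula-2 (suc zero)          zero       zero       m             ()
  formula-2 (suc (suc (suc h))) zero       zero       m             ()
  formula-2 zero                zero       (suc zero) zero          eq = refl
  formula-2 zero                zero       (suc zero) (suc m)       eq = refl
  formula-2 (suc h)             zero       (suc zero) m             ()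
  formula-2 h                   zero       (suc (suc k)) m          eq
    with trans eq (trans (pathLength-sucᵏ 0 (suc k) h) (cong (2 +_) (pathLength-sucᵏ 0 k h)))
  ... | ()
  formula-2 zero                (suc zero) zero       zero          eq = refl
  formula-2 zero                (suc zero) zero       (suc zero)    eq = refl
  formula-2 zero                (suc zero) zero       (suc (suc m)) eq = refl
  formula-2 (suc h)             (suc zero) zero       m             ()
  formula-2 h                   (suc zero) (suc k)    m             eq
    with trans eq (trans (pathLength-sucᵉ 0 (suc k) h) (cong (2 +_) (pathLength-sucᵏ 0 k h)))
  ... | ()
  formula-2 h                   (suc (suc e)) k       m             eq
    with trans eq (trans (pathLength-sucᵉ (suc e) k h) (cong (2 +_) (pathLength-sucᵉ e k h)))
  ... | ()

  paths-formula : ∀ ℓ → PathFormula ℓ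
  paths-formula = <-rec PathFormula formula
    where
    formula : ∀ ℓ → (∀ {ℓ′} → ℓ′ < ℓ → PathFormula ℓ′) → PathFormula ℓ
    formula 0                   _   = formula-0
    formula 1                   _   = formula-1
    formula 2                   _   = formula-2
    formula (suc (suc (suc ℓ))) rec =
      formula-step ℓ (rec (m<n⇒m<1+n (m<n⇒m<1+n (n<1+n ℓ))))
                     (rec (m<n⇒m<1+n (n<1+n (1 + ℓ))))
                     (rec (n<1+n (2 + ℓ)))

  length-filter≡sum-counted : ∀ k m ws →
    length (filter (λ w → T? ((countUD w ≡ᵇ k) ∧ (countUUD w ≡ᵇ m))) (filter (λ w → T? (isDyck w)) ws))
    ≡ sum (map (counted 0 k m) ws)
  length-filter≡sum-counted k m []       = refl
  length-filter≡sum-counted k m (w ∷ ws) with dyckFrom 0 w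
  ... | false = length-filter≡sum-counted k m ws
  ... | true with (countUD w ≡ᵇ k) ∧ (countUUD w ≡ᵇ m)
  ...   | false = length-filter≡sum-counted k m ws
  ...   | true  = cong suc (length-filter≡sum-counted k m ws)

  wnkm-formula : ∀ e k m → suc (e + k) * wnkm (e + k) k m ≡ C (suc (e + k)) k * A e k m
  wnkm-formula e k m =
    trans (cong (suc n *_) (length-filter≡sum-counted k m (words (n + n))))
      (trans (subst (λ d → suc d * paths (n + n) 0 k m ≡ 1 * (C (suc d) k * A e k m)) (+-identityʳ n)
                    (paths-formula (n + n) 0 e k m (sym (+-identityʳ (n + n)))))
             (*-identityˡ _))
    where n = e + k

  wnkm-vanish : ∀ e k m → k < m → wnkm (e + k) k m ≡ 0
  wnkm-vanish e k m k<m = *-cancelˡ-≡ _ 0 (suc (e + k)) (trans (wnkm-formula e k m)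
    (*-vanish (C (suc (e + k)) k) (suc (e + k)) (trans (cong (comp e m *_) (C-vanish k<m)) (*-zeroʳ (comp e m))) refl))

  wnkm-weighted : ∀ e k m → e * (suc (e + k) * wnkm (e + k) k m) ≡ C (suc (e + k)) k * (m * C e m * C k m)
  wnkm-weighted e k m = begin
    e * (suc (e + k) * wnkm (e + k) k m)       ≡⟨ cong (e *_) (wnkm-formula e k m) ⟩
    e * (C (suc (e + k)) k * (comp e m * C k m)) ≡⟨ regroup e (C (suc (e + k)) k) (comp e m) (C k m) ⟩
    C (suc (e + k)) k * (e * comp e m * C k m)   ≡⟨ cong (λ z → C (suc (e + k)) k * (z * C k m)) (comp-C e m) ⟩
    C (suc (e + k)) k * (m * C e m * C k m)      ∎
    where
    open ≡-Reasoning
    regroup : ∀ e c x y → e * (c * (x * y)) ≡ c * (e * x * y)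
    regroup = solve-∀

  wnkm-proportional : ∀ j k m →
    k * C (suc (j + k)) k * wnkm (j + k) j m ≡ j * C (suc (j + k)) j * wnkm (j + k) k m
  wnkm-proportional j k m = *-cancelˡ-≡ _ _ (suc n) (begin
    suc n * (k * Cₖ * wnkm n j m)               ≡⟨ regroup n k Cₖ (wnkm n j m) ⟩
    Cₖ * (k * (suc n * wnkm n j m))             ≡⟨ cong (Cₖ *_) weightedⱼ ⟩
    Cₖ * (Cⱼ * (m * C k m * C j m))             ≡⟨ swap Cₖ Cⱼ m (C k m) (C j m) ⟩
    Cⱼ * (Cₖ * (m * C j m * C k m))             ≡⟨ cong (Cⱼ *_) (wnkm-weighted j k m) ⟨
    Cⱼ * (j * (suc n * wnkm n k m))             ≡⟨ regroup n j Cⱼ (wnkm n k m) ⟨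
    suc n * (j * Cⱼ * wnkm n k m)               ∎)
    where
    open ≡-Reasoning
    n = j + k
    Cₖ = C (suc n) k
    Cⱼ = C (suc n) j
    weightedⱼ : k * (suc n * wnkm n j m) ≡ Cⱼ * (m * C k m * C j m)
    weightedⱼ = subst (λ n′ → k * (suc n′ * wnkm n′ j m) ≡ C (suc n′) j * (m * C k m * C j m))
                      (+-comm k j) (wnkm-weighted k j m)
    regroup : ∀ n k c w → suc n * (k * c * w) ≡ c * (k * (suc n * w))
    regroup = solve-∀
    swap : ∀ a b m x y → a * (b * (m * x * y)) ≡ b * (a * (m * y * x))
    swap = solve-∀

  k*C≢0 : ∀ {n k} → 0 < k → k ≤ n → k * C n k ≢ 0
  k*C≢0 {n} {k} 0<k k≤n eq with m*n≡0⇒m≡0∨n≡0 k eq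
  ... | inj₁ k≡0 = n>0⇒n≢0 0<k k≡0
  ... | inj₂ C≡0 = C-nonzero k≤n C≡0

module Roots {c ℓ : Level} (R : CommutativeRing c ℓ) where

  open import Data.Product using (_,_)
  open import Data.Sum using (inj₁; inj₂)
  open import Relation.Nullary using (¬_; contradiction)
  open ≡ using (_≡_; _≢_)

  open CommutativeRing R
  open Counting using (C; wnkm-vanish; wnkm-proportional)
  open import Algebra.Properties.Semiring.Mult semiring using (_×_; ×1-homo-*)
  open import Relation.Binary.Reasoning.Setoid setoid

  ιℕ≡×1# : ∀ n → ιℕ R n ≡ n × 1#
  ιℕ≡×1# zero    = ≡.refl
  ιℕ≡×1# (suc n) = ≡.cong (1# +_) (ιℕ≡×1# n)

  ιℕ-homo-* : ∀ m n → ιℕ R (m ℕ.* n) ≈ ιℕ R m * ιℕ R n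
  ιℕ-homo-* m n rewrite ιℕ≡×1# (m ℕ.* n) | ιℕ≡×1# m | ιℕ≡×1# n = ×1-homo-* m n

  ιℕ-nonzero : CharZero R → ∀ {n} → n ≢ 0 → ¬ ιℕ R n ≈ 0#
  ιℕ-nonzero char {zero}  n≢0 = contradiction ≡.refl n≢0
  ιℕ-nonzero char {suc n} _   = char n

  polySum-cong : ∀ {f g} j x → (∀ m → f m ≡ g m) → polySum R f j x ≡ polySum R g j x
  polySum-cong zero    x f≗g = ≡.cong (ιℕ R) (f≗g 0)
  polySum-cong (suc j) x f≗g =
    ≡.cong₂ (λ s a → s + ιℕ R a * pow R x (suc j)) (polySum-cong j x f≗g) (f≗g (suc j))

  polySum-scale : ∀ a f j x → polySum R (λ m → a ℕ.* f m) j x ≈ ιℕ R a * polySum R f j x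
  polySum-scale a f zero    x = ιℕ-homo-* a (f 0)
  polySum-scale a f (suc j) x = begin
    polySum R (λ m → a ℕ.* f m) j x + ιℕ R (a ℕ.* f (suc j)) * xʲ
      ≈⟨ +-cong (polySum-scale a f j x) (*-congʳ (ιℕ-homo-* a (f (suc j)))) ⟩
    ιℕ R a * polySum R f j x + ιℕ R a * ιℕ R (f (suc j)) * xʲ
      ≈⟨ +-congˡ (*-assoc (ιℕ R a) (ιℕ R (f (suc j))) xʲ) ⟩
    ιℕ R a * polySum R f j x + ιℕ R a * (ιℕ R (f (suc j)) * xʲ)
      ≈⟨ distribˡ (ιℕ R a) _ _ ⟨
    ιℕ R a * (polySum R f j x + ιℕ R (f (suc j)) * xʲ)
      ∎
    where xʲ = pow R x (suc j)

  polySum-extend : ∀ f j t x → (∀ m → j ℕ.< m → f m ≡ 0) → polySum R f (j ℕ.+ t) x ≈ polySum R f j x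
  polySum-extend f j zero    x high rewrite ℕₚ.+-identityʳ j = refl
  polySum-extend f j (suc t) x high rewrite ℕₚ.+-suc j t = begin
    polySum R f (j ℕ.+ t) x + ιℕ R (f (suc (j ℕ.+ t))) * pow R x (suc (j ℕ.+ t))
      ≈⟨ +-congˡ (*-congʳ (reflexive (≡.cong (ιℕ R) (high _ (s≤s (ℕₚ.m≤m+n j t)))))) ⟩
    polySum R f (j ℕ.+ t) x + 0# * pow R x (suc (j ℕ.+ t))
      ≈⟨ +-congˡ (zeroˡ _) ⟩
    polySum R f (j ℕ.+ t) x + 0#
      ≈⟨ +-identityʳ _ ⟩
    polySum R f (j ℕ.+ t) x
      ≈⟨ polySum-extend f j t x high ⟩
    polySum R f j x
      ∎

  W-proportional : ∀ j k x →
    ιℕ R (j ℕ.* C (suc (j ℕ.+ k)) j) * W R (j ℕ.+ k) k x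
    ≈ ιℕ R (k ℕ.* C (suc (j ℕ.+ k)) k) * W R (j ℕ.+ k) j x
  W-proportional j k x = begin
    ιℕ R b * polySum R wₖ k x             ≈⟨ *-congˡ (polySum-extend wₖ k j x (wnkm-vanish j k)) ⟨
    ιℕ R b * polySum R wₖ (k ℕ.+ j) x     ≈⟨ polySum-scale b wₖ (k ℕ.+ j) x ⟨
    polySum R (λ m → b ℕ.* wₖ m) (k ℕ.+ j) x
      ≡⟨ ≡.cong (λ t → polySum R (λ m → b ℕ.* wₖ m) t x) (ℕₚ.+-comm k j) ⟩
    polySum R (λ m → b ℕ.* wₖ m) (j ℕ.+ k) x
      ≡⟨ polySum-cong (j ℕ.+ k) x (λ m → ≡.sym (wnkm-proportional j k m)) ⟩
    polySum R (λ m → a ℕ.* wⱼ m) (j ℕ.+ k) x ≈⟨ polySum-scale a wⱼ (j ℕ.+ k) x ⟩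
    ιℕ R a * polySum R wⱼ (j ℕ.+ k) x     ≈⟨ *-congˡ (polySum-extend wⱼ j k x wⱼ-vanish) ⟩
    ιℕ R a * polySum R wⱼ j x             ∎
    where
    n = j ℕ.+ k
    a = k ℕ.* C (suc n) k
    b = j ℕ.* C (suc n) j
    wⱼ = wnkm n j
    wₖ = wnkm n k
    wⱼ-vanish : ∀ m → j ℕ.< m → wⱼ m ≡ 0
    wⱼ-vanish m j<m = ≡.subst (λ n′ → wnkm n′ j m ≡ 0) (ℕₚ.+-comm k j) (wnkm-vanish k j m j<m)

  sameRoots-of-proportional : IsIntegralDomain R → ∀ {a b p q} → ¬ a ≈ 0# → ¬ b ≈ 0# →
    (∀ x → a * p x ≈ b * q x) → SameRoots R p q
  sameRoots-of-proportional (_ , domain) {a} {b} {p} {q} a≉0 b≉0 prop x = to , from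
    where
    cancel : ∀ {u v} → ¬ u ≈ 0# → u * v ≈ 0# → v ≈ 0#
    cancel {u} {v} u≉0 uv≈0 with domain u v uv≈0
    ... | inj₁ u≈0 = contradiction u≈0 u≉0
    ... | inj₂ v≈0 = v≈0
    to : p x ≈ 0# → q x ≈ 0#
    to px≈0 = cancel b≉0 (trans (sym (prop x)) (trans (*-congˡ px≈0) (zeroʳ a)))
    from : q x ≈ 0# → p x ≈ 0#
    from qx≈0 = cancel a≉0 (trans (prop x) (trans (*-congˡ qx≈0) (zeroʳ b)))

open Counting using (k*C≢0)
open Roots

proposition6p1 : {c ℓ : Level} (R : CommutativeRing c ℓ) →
    IsIntegralDomain R → CharZero R →
    (n k : ℕ) → 1 ≤ k → k ≤ n ∸ 1 →
    SameRoots R (W R n k) (W R n (n ∸ k))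
proposition6p1 R domain char zero    k (s≤s z≤n) ()
proposition6p1 R domain char (suc n) k 0<k k≤n =
  ≡.subst (λ n′ → SameRoots R (W R n′ k) (W R n′ j)) (ℕₚ.m∸n+n≡m k≤1+n)
    (sameRoots-of-proportional R domain
      (ιℕ-nonzero R char (k*C≢0 0<j (ℕₚ.m≤n⇒m≤1+n (ℕₚ.m≤m+n j k))))
      (ιℕ-nonzero R char (k*C≢0 0<k (ℕₚ.m≤n⇒m≤1+n (ℕₚ.m≤n+m k j))))
      (W-proportional R j k))
  where
  j = suc n ∸ k
  k≤1+n = ℕₚ.m≤n⇒m≤1+n k≤n
  0<j = ℕₚ.m<n⇒0<n∸m (s≤s k≤n)
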